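{- Let $T=(\mathbf{P},A,\to)$ be a labelled transition system whose action set is partitioned as $A=A^r\uplus A^l$ (no bivariant actions), let $c^l\in A^l$, and assume $T$ has no transition labelled $c^l$. Let $\mathcal{T}^+_{c^l}(T)$ be the LTS obtained from $T$ by adding a fresh state $u$ with transitions $u\xrightarrow{b}u$ for every $b\in A^l$ (and no other outgoing transitions), and a transition $p\xrightarrow{c^l}u$ for every state $p\in\mathbf{P}$. Then for all states $p,q\in\mathbf{P}$: $p\lesssim_{cc}q$ in $T$ if and only if $p\lesssim_{cc}q$ in $\mathcal{T}^+_{c^l}(T)$.
   Context: For an LTS with action set partitioned as $A=A^r\uplus A^l$, a covariant-contravariant simulation is a relation $R$ on its states such that whenever $p\,R\,q$: for all $a\in A^r$ and all $p\xrightarrow{a}p'$ there is $q\xrightarrow{a}q'$ with $p'\,R\,q'$; and for all $b\in A^l$ and all $q\xrightarrow{b}q'$ there is $p\xrightarrow{b}p'$ with $p'\,R\,q'$. $p\lesssim_{cc}q$ in that LTS iff some covariant-contravariant simulation on it contains $(p,q)$. -}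

module Defs where

open import Level using (Level; _⊔_; suc)
open import Data.Sum using (_⊎_; inj₁; inj₂)
open import Data.Product using (Σ; ∃; _×_; _,_)
open import Data.Maybe using (Maybe; just; nothing)
open import Relation.Binary.PropositionalEquality using (_≡_)

-- A labelled transition system over states P whose action set is
-- partitioned as A = Ar ⊎ Al (inj₁ = covariant, inj₂ = contravariant).
record LTS (s a t : Level) : Set (Level.suc (s ⊔ a ⊔ t)) where
  field
    State : Set s
    Ar    : Set a
    Al    : Set a
    _⟶[_]_ : State → Ar ⊎ Al → State → Set t

open LTS public

IsCCSim : ∀ {s a t r} (T : LTS s a t) → (State T → State T → Set r) → Set (s ⊔ a ⊔ t ⊔ r)
IsCCSim T R =
  ∀ {p q} → R p q →
    (∀ (a : Ar T) p' → _⟶[_]_ T p (inj₁ a) p' →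
       Σ (State T) λ q' → _⟶[_]_ T q (inj₁ a) q' × R p' q')
  × (∀ (b : Al T) q' → _⟶[_]_ T q (inj₂ b) q' →
       Σ (State T) λ p' → _⟶[_]_ T p (inj₂ b) p' × R p' q')

-- p ≲cc q: some cc-simulation contains (p , q).  Relations are taken in
-- universe level  s ⊔ a ⊔ t  (large enough to contain the relation
-- built from the LTS data).
_⊢_≲cc_ : ∀ {s a t} (T : LTS s a t) → State T → State T → Set (Level.suc (s ⊔ a ⊔ t))
_⊢_≲cc_ {s} {a} {t} T p q =
  Σ (State T → State T → Set (s ⊔ a ⊔ t)) λ R → IsCCSim T R × R p q

-- Transitions of the extended LTS T⁺_{c} : fresh state u = nothing.
data PlusStep {s a t} (T : LTS s a t) (c : Al T) :
     Maybe (State T) → Ar T ⊎ Al T → Maybe (State T) → Set (s ⊔ a ⊔ t) where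
  old  : ∀ {p α p'} → _⟶[_]_ T p α p' → PlusStep T c (just p) α (just p')
  loop : ∀ (b : Al T) → PlusStep T c nothing (inj₂ b) nothing
  toU  : ∀ (p : State T) → PlusStep T c (just p) (inj₂ c) nothing

plusC : ∀ {s a t} (T : LTS s a t) → Al T → LTS s a (s ⊔ a ⊔ t)
plusC T c = record
  { State = Maybe (State T)
  ; Ar = Ar T
  ; Al = Al T
  ; _⟶[_]_ = PlusStep T c
  }

-- Both directions transport a simulation between the two systems.
--  * Forward: a cc-simulation R on T extends to T⁺ by additionally relating
--    u with itself (extendRel).  The new c-step q → u is answered by p → u,
--    and u simulates itself because it only has contravariant loops.  This
--    direction does not need the hypothesis on c.
--  * Backward: a cc-simulation on T⁺ restricts to the old states
--    (restrictRel).  Old transitions are answered by transitions of T⁺ from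
--    old states; the only new such transitions are the c-steps into u, and
--    these cannot answer a transition of T, since T has no c-transition.
module Submission where

open import Defs
open import Level using (Level; _⊔_; suc)
open import Data.Sum using (inj₁; inj₂)
open import Data.Maybe using (Maybe; just; nothing)
open import Data.Product using (_×_; _,_; Σ; proj₁; proj₂)
open import Data.Unit.Polymorphic using (⊤)
open import Data.Empty.Polymorphic using (⊥)
open import Data.Empty using (⊥-elim)
open import Relation.Nullary using (¬_)

module _ {s a t : Level} (T : LTS s a t) (c : Al T) where

  Rel : Set (suc (s ⊔ a ⊔ t))
  Rel = State T → State T → Set (s ⊔ a ⊔ t)

  Rel⁺ : Set (suc (s ⊔ a ⊔ t))
  Rel⁺ = Maybe (State T) → Maybe (State T) → Set (s ⊔ a ⊔ t)

  extendRel : Rel → Rel⁺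
  extendRel R (just p) (just q) = R p q
  extendRel R nothing  nothing  = ⊤
  extendRel R _        _        = ⊥

  restrictRel : Rel⁺ → Rel
  restrictRel R p q = R (just p) (just q)

  extend-sim : ∀ R → IsCCSim T R → IsCCSim (plusC T c) (extendRel R)
  extend-sim R sim {just p} {just q} pRq = covariant , contravariant
    where
    covariant : ∀ α p⁺ → PlusStep T c (just p) (inj₁ α) p⁺ →
                Σ _ λ q⁺ → PlusStep T c (just q) (inj₁ α) q⁺ × extendRel R p⁺ q⁺
    covariant α _ (old p→p') with proj₁ (sim pRq) α _ p→p'
    ... | q' , q→q' , p'Rq' = just q' , old q→q' , p'Rq'

    contravariant : ∀ b q⁺ → PlusStep T c (just q) (inj₂ b) q⁺ →
                    Σ _ λ p⁺ → PlusStep T c (just p) (inj₂ b) p⁺ × extendRel R p⁺ q⁺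
    contravariant b _ (old q→q') with proj₂ (sim pRq) b _ q→q'
    ... | p' , p→p' , p'Rq' = just p' , old p→p' , p'Rq'
    contravariant _ _ (toU _) = nothing , toU p , _
  extend-sim R sim {nothing} {nothing} _ =
      (λ _ _ ())
    , λ { b _ (loop _) → nothing , loop b , _ }

  restrict-sim : (∀ p p' → ¬ (_⟶[_]_ T p (inj₂ c) p')) →
                 ∀ R → IsCCSim (plusC T c) R → IsCCSim T (restrictRel R)
  restrict-sim noC R sim {p} {q} pRq = covariant , contravariant
    where
    covariant : ∀ α p' → _⟶[_]_ T p (inj₁ α) p' →
                Σ _ λ q' → _⟶[_]_ T q (inj₁ α) q' × restrictRel R p' q'
    covariant α p' p→p' with proj₁ (sim pRq) α (just p') (old p→p')
    ... | _ , old q→q' , p'Rq' = _ , q→q' , p'Rq'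

    contravariant : ∀ b q' → _⟶[_]_ T q (inj₂ b) q' →
                    Σ _ λ p' → _⟶[_]_ T p (inj₂ b) p' × restrictRel R p' q'
    contravariant b q' q→q' with proj₂ (sim pRq) b (just q') (old q→q')
    ... | _ , old p→p' , p'Rq' = _ , p→p' , p'Rq'
    -- an answer p → u would force b = c, making q → q' a c-step of T
    ... | _ , toU _ , _ = ⊥-elim (noC q q' q→q')

proposition21 : ∀ {s a t : Level} (T : LTS s a t) (c : Al T) →
    (∀ p p' → ¬ (_⟶[_]_ T p (inj₂ c) p')) →
    ∀ (p q : State T) →
      ((T ⊢ p ≲cc q) → (plusC T c ⊢ just p ≲cc just q))
      × ((plusC T c ⊢ just p ≲cc just q) → (T ⊢ p ≲cc q))
proposition21 T c noC p q = forward , backward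
  where
  forward : T ⊢ p ≲cc q → plusC T c ⊢ just p ≲cc just q
  forward (R , sim , pRq) = extendRel T c R , extend-sim T c R sim , pRq

  backward : plusC T c ⊢ just p ≲cc just q → T ⊢ p ≲cc q
  backward (R , sim , pRq) = restrictRel T c R , restrict-sim T c noC R sim , pRq
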